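{- Let $(G,\bm{\gamma})$ be a $\mathbb{Z}^2$-colored graph such that $G$ is a $(2,2)$-graph. Then $(G,\bm{\gamma})$ is a Ross graph if and only if, for any Laman basis $L$ of $G$, the fundamental Laman circuit with respect to $L$ of every edge $ij\in E(G)\setminus E(L)$ has non-trivial $\mathbb{Z}^2$-image.
   Context: A colored graph $(G,\bm{\gamma})$ over an abelian group $\Gamma$ consists of a finite directed (multi)graph $G=(V,E)$ with $n$ vertices and $m$ edges, and an element $\gamma_{ij}\in\Gamma$ for each edge. For a cycle $C$ with a fixed traversal order, $\rho(C)=\sum_{\text{forward edges}}\gamma_{ij}-\sum_{\text{backward edges}}\gamma_{ij}$; a subgraph has trivial $\Gamma$-image if $\rho(C)=0$ for all cycles $C$ in it, non-trivial otherwise. For a subgraph, $n'$ is the number of vertices it spans, $m'$ its number of edges. A graph is $(k,\ell)$-sparse if every non-empty subgraph has $m'\le kn'-\ell$, and a $(k,\ell)$-graph if moreover $m=kn-\ell$. A $(k,\ell)$-circuit is an edge-minimal graph that is not $(k,\ell)$-sparse. A $(k,\ell)$-basis of $G$ is a maximal $(k,\ell)$-sparse subgraph (edge subset); for a basis $B$ and an edge $e\notin B$, the fundamental $(k,\ell)$-circuit of $e$ with respect to $B$ is the unique $(k,\ell)$-circuit in $B+e$. "Laman" means $(2,3)$. With $\Gamma=\mathbb{Z}^2$, $(G,\bm{\gamma})$ is a Ross graph if $m=2n-2$, every non-empty subgraph with trivial image has $m'\le 2n'-3$, and every non-empty subgraph with non-trivial image has $m'\le 2n'-2$. -}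

module Defs where

open import Data.Nat using (ℕ; zero; suc; _+_; _*_; _≤_)
open import Data.Integer as ℤ using (ℤ)
open import Data.Bool using (Bool; true; false)
open import Data.Product using (_×_; _,_; proj₁; proj₂; Σ; ∃)
open import Data.Fin using (Fin; zero; suc; inject₁; fromℕ)
open import Data.Fin.Subset using (Subset; _∈_; _∉_; _⊆_; ∣_∣; Nonempty; _∪_; ⁅_⁆)
open import Data.Fin.Subset.Properties using (_∈?_)
open import Data.Fin.Properties using (any?)
open import Data.Vec using (tabulate)
open import Data.Sum using (_⊎_)
open import Function using (Injective)
open import Relation.Binary.PropositionalEquality using (_≡_; _≢_)
open import Relation.Nullary using (¬_)
open import Relation.Nullary.Decidable using (⌊_⌋; _×-dec_; _⊎-dec_)
import Data.Fin as F

Z2 : Set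
Z2 = ℤ × ℤ

0² : Z2
0² = ℤ.0ℤ , ℤ.0ℤ

_+²_ : Z2 → Z2 → Z2
(a , b) +² (c , d) = (a ℤ.+ c) , (b ℤ.+ d)

-²_ : Z2 → Z2
-² (a , b) = ℤ.- a , ℤ.- b

sum² : ∀ {k} → (Fin k → Z2) → Z2
sum² {zero} f = 0²
sum² {suc k} f = f zero +² sum² (λ i → f (suc i))

-- Z²-colored finite directed multigraphs: vertices Fin n, edges Fin m,
-- edge e goes from src e to tgt e and has color γ e.

record ColoredGraph : Set where
  field
    n   : ℕ
    m   : ℕ
    src : Fin m → Fin n
    tgt : Fin m → Fin n
    γ   : Fin m → Z2

module _ (G : ColoredGraph) where
  open ColoredGraph G

  -- subgraphs are edge subsets; allEdges is E(G)
  EdgeSet : Set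
  EdgeSet = Subset m

  allEdges : EdgeSet
  allEdges = tabulate (λ _ → true)

  spanned : EdgeSet → Subset n
  spanned F = tabulate (λ v →
    ⌊ any? (λ e → (e ∈? F) ×-dec ((F._≟_ v (src e)) ⊎-dec (F._≟_ v (tgt e)))) ⌋)

  n' : EdgeSet → ℕ
  n' F = ∣ spanned F ∣

  m' : EdgeSet → ℕ
  m' F = ∣ F ∣

  -- m' ≤ k n' - ℓ, written without truncated subtraction
  CountOK : ℕ → ℕ → EdgeSet → Set
  CountOK k ℓ F = m' F + ℓ ≤ k * n' F

  Sparse : ℕ → ℕ → EdgeSet → Set
  Sparse k ℓ F = ∀ (F′ : EdgeSet) → F′ ⊆ F → Nonempty F′ → CountOK k ℓ F′

  IsKLGraph : ℕ → ℕ → Set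
  IsKLGraph k ℓ = Sparse k ℓ allEdges × (m + ℓ ≡ k * n)

  IsCircuit : ℕ → ℕ → EdgeSet → Set
  IsCircuit k ℓ C = ¬ Sparse k ℓ C × (∀ C′ → C′ ⊆ C → C′ ≢ C → Sparse k ℓ C′)

  IsBasis : ℕ → ℕ → EdgeSet → Set
  IsBasis k ℓ B = Sparse k ℓ B × (∀ e → e ∉ B → ¬ Sparse k ℓ (B ∪ ⁅ e ⁆))

  -- a traversal step: an edge, traversed forward (true) or backward (false)
  Step : Set
  Step = Fin m × Bool

  stepTail : Step → Fin n
  stepTail (e , true)  = src e
  stepTail (e , false) = tgt e

  stepHead : Step → Fin n
  stepHead (e , true)  = tgt e
  stepHead (e , false) = src e

  stepGain : Step → Z2
  stepGain (e , true)  = γ e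
  stepGain (e , false) = -² γ e

  record Cycle (F : EdgeSet) : Set where
    field
      k       : ℕ
      steps   : Fin (suc k) → Step
      inF     : ∀ i → proj₁ (steps i) ∈ F
      chain   : ∀ (i : Fin k) → stepHead (steps (inject₁ i)) ≡ stepTail (steps (suc i))
      closed  : stepHead (steps (fromℕ k)) ≡ stepTail (steps zero)
      edgesDistinct : Injective _≡_ _≡_ (λ i → proj₁ (steps i))
      vertsDistinct : Injective _≡_ _≡_ (λ i → stepTail (steps i))

  ρ : ∀ {F} → Cycle F → Z2
  ρ c = sum² (λ i → stepGain (Cycle.steps c i))

  TrivialImage : EdgeSet → Set
  TrivialImage F = ∀ (c : Cycle F) → ρ c ≡ 0²

  NontrivialImage : EdgeSet → Set
  NontrivialImage F = ¬ TrivialImage F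

  IsRoss : Set
  IsRoss = (m + 2 ≡ 2 * n)
         × (∀ F → Nonempty F → TrivialImage F → CountOK 2 3 F)
         × (∀ F → Nonempty F → NontrivialImage F → CountOK 2 2 F)

  FundamentalLamanCircuitsNontrivial : Set
  FundamentalLamanCircuitsNontrivial =
    ∀ L → IsBasis 2 3 L → ∀ e → e ∉ L →
      ∀ C → C ⊆ (L ∪ ⁅ e ⁆) → IsCircuit 2 3 C → NontrivialImage C

module Submission where

-- The count m = 2n - 2 and the (2,2)-bound
-- for non-trivial subgraphs are part of the hypothesis, so G is Ross exactly
-- when every subgraph with trivial image satisfies the Laman count.
--
-- (⇒) A Laman circuit C with trivial image would have all its non-empty
--     subgraphs trivial, hence Laman-sparse by the Ross condition, so C itself
--     would be Laman-sparse: impossible.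
-- (⇐) If a subgraph F with trivial image violates the Laman count, then F is
--     not Laman-sparse, and a purely matroidal lemma produces a Laman basis L,
--     an edge e ∉ L and a Laman circuit C ⊆ (L + e) ∩ F: extend a maximal
--     sparse subset B of F to a basis L of G, pick e ∈ F - B, and take a
--     circuit inside B + e.  C inherits the trivial image of F, contradicting
--     the hypothesis on fundamental circuits.

open import Defs
open import Function.Bundles using (_⇔_; mk⇔)
open import Data.Nat using (ℕ; _+_; _*_; _<_)
open import Data.Nat.Properties using (_≤?_)
open import Data.Nat.Induction using (<-wellFounded)
open import Data.Fin using (Fin; zero; suc)
open import Data.Fin.Subset
open import Data.Fin.Subset.Properties
open import Data.Fin.Properties using (any?)
open import Data.Product using (_,_; proj₁; proj₂; ∃-syntax; _×_)
open import Data.Sum using (inj₁; inj₂)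
open import Data.Empty using (⊥-elim)
open import Data.Bool using (true)
open import Data.Vec using (tabulate; here; there)
import Data.Vec.Properties as Vec
import Data.Bool.Properties as Bool
open import Data.List using (List; allFin; []; _∷_)
import Data.List.Membership.Propositional as List
open import Data.List.Membership.Propositional.Properties using (∈-allFin)
open import Data.List.Relation.Unary.Any using () renaming (here to hereₗ; there to thereₗ)
open import Induction.WellFounded using (Acc; acc)
open import Relation.Binary.Construct.On as On using ()
open import Relation.Nullary using (¬_; Dec; yes; no; ¬?)
open import Relation.Nullary.Decidable using (_×-dec_; decidable-stable)
open import Relation.Binary.PropositionalEquality using (_≡_; _≢_; refl; subst; sym)

∈-allTrue : ∀ {k} (x : Fin k) → x ∈ tabulate (λ _ → true)
∈-allTrue zero    = here
∈-allTrue (suc x) = there (∈-allTrue x)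

∪-least : ∀ {k} {p q r : Subset k} → p ⊆ r → q ⊆ r → p ∪ q ⊆ r
∪-least {p = p} {q} p⊆r q⊆r x∈p∪q with x∈p∪q⁻ p q x∈p∪q
... | inj₁ x∈p = p⊆r x∈p
... | inj₂ x∈q = q⊆r x∈q

⁅⁆⊆ : ∀ {k} {e : Fin k} {r : Subset k} → e ∈ r → ⁅ e ⁆ ⊆ r
⁅⁆⊆ {e = e} {r} e∈r x∈⁅e⁆ = subst (_∈ r) (sym (x∈⁅y⁆⇒x≡y e x∈⁅e⁆)) e∈r

⊆-by-complement : ∀ {k} {p q : Subset k} →
  ¬ (∃[ x ] (x ∈ q × x ∉ p)) → q ⊆ p
⊆-by-complement {p = p} none {x} x∈q =
  decidable-stable (x ∈? p) (λ x∉p → none (x , x∈q , x∉p))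

⊆∧≢⇒⊂ : ∀ {k} {p q : Subset k} → p ⊆ q → p ≢ q → p ⊂ q
⊆∧≢⇒⊂ {p = p} {q} p⊆q p≢q with any? (λ x → (x ∈? q) ×-dec ¬? (x ∈? p))
... | yes (x , x∈q , x∉p) = p⊆q , x , x∈q , x∉p
... | no none = ⊥-elim (p≢q (⊆-antisym p⊆q (⊆-by-complement none)))

module _ (G : ColoredGraph) where
  open ColoredGraph G

  cycle-⊆ : ∀ {F C} → F ⊆ C → Cycle G F → Cycle G C
  cycle-⊆ F⊆C c = record
    { k = k ; steps = steps ; inF = λ i → F⊆C (inF i)
    ; chain = chain ; closed = closed
    ; edgesDistinct = edgesDistinct ; vertsDistinct = vertsDistinct }
    where open Cycle c

  trivialImage-⊆ : ∀ {F C} → F ⊆ C → TrivialImage G C → TrivialImage G F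
  trivialImage-⊆ F⊆C trivial c = trivial (cycle-⊆ F⊆C c)

  module Sparsity (k ℓ : ℕ) where

    sparse-⊆ : ∀ {X Y} → X ⊆ Y → Sparse G k ℓ Y → Sparse G k ℓ X
    sparse-⊆ X⊆Y sparseY F F⊆X = sparseY F (⊆-trans F⊆X X⊆Y)

    countOK? : ∀ X → Dec (CountOK G k ℓ X)
    countOK? X = m' G X + ℓ ≤? k * n' G X

    sparse? : ∀ X → Dec (Sparse G k ℓ X)
    sparse? X with anySubset? (λ F → (F ⊆? X) ×-dec (nonempty? F ×-dec ¬? (countOK? F)))
    ... | yes (F , F⊆X , ne , bad) = no (λ sparseX → bad (sparseX F F⊆X ne))
    ... | no none = yes (λ F F⊆X ne →
          decidable-stable (countOK? F) (λ bad → none (F , F⊆X , ne , bad)))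

    _≟ₛ_ : (p q : EdgeSet G) → Dec (p ≡ q)
    _≟ₛ_ = Vec.≡-dec Bool._≟_

    -- Every non-sparse edge set contains a circuit.  Induction on the size of
    -- X: either a proper non-sparse subset exists (recurse), or X is minimal.
    circuit-⊆ : ∀ X → ¬ Sparse G k ℓ X → ∃[ C ] (C ⊆ X × IsCircuit G k ℓ C)
    circuit-⊆ X = go X (On.wellFounded ∣_∣ <-wellFounded X)
      where
      go : ∀ X → Acc (λ p q → ∣ p ∣ < ∣ q ∣) X → ¬ Sparse G k ℓ X →
           ∃[ C ] (C ⊆ X × IsCircuit G k ℓ C)
      go X (acc smaller) ¬sparseX
        with anySubset? (λ Y → (Y ⊆? X) ×-dec (¬? (Y ≟ₛ X) ×-dec ¬? (sparse? Y)))
      ... | yes (Y , Y⊆X , Y≢X , ¬sparseY) =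
        let (C , C⊆Y , circuit) = go Y (smaller (p⊂q⇒∣p∣<∣q∣ (⊆∧≢⇒⊂ Y⊆X Y≢X))) ¬sparseY
        in C , ⊆-trans C⊆Y Y⊆X , circuit
      ... | no none = X , ⊆-refl , ¬sparseX , λ Y Y⊆X Y≢X →
            decidable-stable (sparse? Y) (λ ¬sparseY → none (Y , Y⊆X , Y≢X , ¬sparseY))

    Blocked : EdgeSet G → Fin m → Set
    Blocked R e = e ∉ R → ¬ Sparse G k ℓ (R ∪ ⁅ e ⁆)

    record MaximalExtension (S A : EdgeSet G) (es : List (Fin m)) : Set where
      field
        set      : EdgeSet G
        base⊆    : S ⊆ set
        ⊆bound   : set ⊆ S ∪ A
        sparse   : Sparse G k ℓ set
        maximal  : ∀ e → e ∈ A → e List.∈ es → Blocked set e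

    -- Greedy algorithm: scan the candidate list, adding an edge of A whenever
    -- the result stays sparse.  A rejected edge stays blocked later, since
    -- the current set only grows.
    greedy : ∀ S A es → Sparse G k ℓ S → MaximalExtension S A es
    greedy S A [] sparseS = record
      { set = S ; base⊆ = ⊆-refl ; ⊆bound = p⊆p∪q A ; sparse = sparseS
      ; maximal = λ _ _ () }
    greedy S A (e ∷ es) sparseS with (e ∈? A) ×-dec sparse? (S ∪ ⁅ e ⁆)
    ... | yes (e∈A , sparseS+e) = record
      { set = set
      ; base⊆ = λ x∈S → base⊆ (p⊆p∪q ⁅ e ⁆ x∈S)
      ; ⊆bound = λ x∈R → ∪-least (∪-least (p⊆p∪q A) (⁅⁆⊆ (q⊆p∪q S A e∈A)))
                                  (q⊆p∪q S A) (⊆bound x∈R)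
      ; sparse = sparse
      ; maximal = λ { _ _ (hereₗ refl) e∉R → ⊥-elim (e∉R (base⊆ (q⊆p∪q S ⁅ e ⁆ (x∈⁅x⁆ e))))
                    ; e′ e′∈A (thereₗ e′∈es) → maximal e′ e′∈A e′∈es } }
      where open MaximalExtension (greedy (S ∪ ⁅ e ⁆) A es sparseS+e)
    ... | no rejected = record
      { set = set ; base⊆ = base⊆ ; ⊆bound = ⊆bound ; sparse = sparse
      ; maximal = λ { e′ e′∈A (hereₗ refl) _ sparseR+e → rejected (e′∈A ,
                        sparse-⊆ (∪-least (λ x∈S → p⊆p∪q ⁅ e′ ⁆ (base⊆ x∈S))
                                          (q⊆p∪q set ⁅ e′ ⁆)) sparseR+e)
                    ; e′ e′∈A (thereₗ e′∈es) → maximal e′ e′∈A e′∈es } }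
      where open MaximalExtension (greedy S A es sparseS)

    maximalExtension : ∀ S A → Sparse G k ℓ S → ∃[ R ]
      (S ⊆ R × R ⊆ S ∪ A × Sparse G k ℓ R × (∀ e → e ∈ A → Blocked R e))
    maximalExtension S A sparseS =
      set , base⊆ , ⊆bound , sparse , λ e e∈A → maximal e e∈A (∈-allFin e)
      where open MaximalExtension (greedy S A (allFin m) sparseS)

    emptySparse : Sparse G k ℓ ⊥
    emptySparse F F⊆⊥ (x , x∈F) = ⊥-elim (∉⊥ (F⊆⊥ x∈F))

    record FundamentalCircuitIn (X : EdgeSet G) : Set where
      field
        basis     : EdgeSet G
        edge      : Fin m
        circuit   : EdgeSet G
        isBasis   : IsBasis G k ℓ basis
        edge∉     : edge ∉ basis
        ⊆basis+e  : circuit ⊆ basis ∪ ⁅ edge ⁆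
        isCircuit : IsCircuit G k ℓ circuit
        ⊆X        : circuit ⊆ X

    -- Take B
    -- maximal sparse inside X, an edge e ∈ X - B, a circuit C ⊆ B + e, and
    -- extend B to a basis L of G; then e ∉ L because B + e ⊆ L + e.
    fundamentalCircuit-⊆ : ∀ X → ¬ Sparse G k ℓ X → FundamentalCircuitIn X
    fundamentalCircuit-⊆ X ¬sparseX
      with maximalExtension ⊥ X emptySparse
    ... | B , _ , B⊆⊥∪X , sparseB , maximalB
      with maximalExtension B (allEdges G) sparseB
    ... | L , B⊆L , _ , sparseL , maximalL
      with any? (λ e → (e ∈? X) ×-dec ¬? (e ∈? B))
    ... | no none = ⊥-elim (¬sparseX (sparse-⊆ (⊆-by-complement none) sparseB))
    ... | yes (e , e∈X , e∉B) = record
      { basis = L ; edge = e ; circuit = C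
      ; isBasis = sparseL , λ e′ → maximalL e′ (∈-allTrue e′)
      ; edge∉ = λ e∈L → ¬sparseB+e (sparse-⊆ (∪-least B⊆L (⁅⁆⊆ e∈L)) sparseL)
      ; ⊆basis+e = λ x∈C → ∪-least (λ x∈B → p⊆p∪q ⁅ e ⁆ (B⊆L x∈B))
                                    (q⊆p∪q L ⁅ e ⁆) (C⊆B+e x∈C)
      ; isCircuit = isCircuit
      ; ⊆X = λ x∈C → ∪-least B⊆X (⁅⁆⊆ e∈X) (C⊆B+e x∈C) }
      where
      B⊆X : B ⊆ X
      B⊆X x∈B = ∪-least ⊥⊆ ⊆-refl (B⊆⊥∪X x∈B)
      ¬sparseB+e : ¬ Sparse G k ℓ (B ∪ ⁅ e ⁆)
      ¬sparseB+e = maximalB e e∈X e∉B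
      circuitB+e : ∃[ C ] (C ⊆ B ∪ ⁅ e ⁆ × IsCircuit G k ℓ C)
      circuitB+e = circuit-⊆ (B ∪ ⁅ e ⁆) ¬sparseB+e
      C : EdgeSet G
      C = proj₁ circuitB+e
      C⊆B+e : C ⊆ B ∪ ⁅ e ⁆
      C⊆B+e = proj₁ (proj₂ circuitB+e)
      isCircuit : IsCircuit G k ℓ C
      isCircuit = proj₂ (proj₂ circuitB+e)

  open Sparsity 2 3

  -- (⇒): in a Ross graph a Laman circuit cannot have trivial image, since all
  -- of its non-empty subgraphs would then satisfy the Laman count.
  ross⇒fundamentalNontrivial : IsRoss G → FundamentalLamanCircuitsNontrivial G
  ross⇒fundamentalNontrivial (_ , trivialCount , _) _ _ _ _ C _ (¬sparseC , _) trivialC =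
    ¬sparseC (λ F F⊆C ne → trivialCount F ne (trivialImage-⊆ F⊆C trivialC))

  -- (⇐), the essential part: a subgraph with trivial image that violated the
  -- Laman count would contain a fundamental Laman circuit with trivial image.
  trivialImage⇒lamanCount : FundamentalLamanCircuitsNontrivial G →
    ∀ F → Nonempty F → TrivialImage G F → CountOK G 2 3 F
  trivialImage⇒lamanCount fundamental F ne trivialF with countOK? F
  ... | yes ok = ok
  ... | no bad = ⊥-elim (fundamental basis isBasis edge edge∉ circuit ⊆basis+e isCircuit
                           (trivialImage-⊆ ⊆X trivialF))
    where open FundamentalCircuitIn (fundamentalCircuit-⊆ F (λ sparseF → bad (sparseF F ⊆-refl ne)))

  -- (⇐): the remaining Ross conditions are the isGraph22 hypothesis.
  fundamentalNontrivial⇒ross : IsKLGraph G 2 2 → FundamentalLamanCircuitsNontrivial G → IsRoss G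
  fundamentalNontrivial⇒ross (sparse22 , count) fundamental =
    count , trivialImage⇒lamanCount fundamental ,
    λ F ne _ → sparse22 F (λ {x} _ → ∈-allTrue x) ne

mainTheorem4 : (G : ColoredGraph) → IsKLGraph G 2 2 →
    (IsRoss G ⇔ FundamentalLamanCircuitsNontrivial G)
mainTheorem4 G isGraph22 =
  mk⇔ (ross⇒fundamentalNontrivial G) (fundamentalNontrivial⇒ross G isGraph22)
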